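{- Let $L(m,n)$ denote the $3$-graph obtained from $L_{K_n}$ by adding $m-1$ copies of its distinguished vertex $u$. Then \[ r(L_{K_s}, L(m,n)) \le m\cdot 2^{n+1}\cdot\left(\binom{s+n-2}{s-1}+1\right)^{n}. \]
   Context: A $3$-graph is a $3$-uniform hypergraph. For $3$-graphs $H_1,H_2$, $r(H_1,H_2)$ is the smallest $N$ such that every $3$-graph on $N$ vertices contains $H_1$ or its complement contains $H_2$. For a graph $G$, the link hypergraph $L_G$ is the $3$-graph on $V(G)\cup\{u\}$ ($u$ a new vertex, called the distinguished vertex) whose edges are the triples $\{u,v,w\}$ with $\{v,w\}\in E(G)$. Adding a copy $u'$ of $u$ means adding a new vertex lying in exactly the edges $\{u',v,w\}$ for $\{u,v,w\}$ an edge containing $u$. $K_n$ is the complete graph on $n$ vertices. -}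

module Defs where

open import Data.Nat using (ℕ; zero; suc; _+_; _*_; _∸_; _^_; _≤_)
open import Data.Nat.Combinatorics using (_C_)
open import Data.Fin using (Fin; _↑ˡ_; _↑ʳ_)
open import Data.Bool using (Bool; true; false; not)
open import Data.Product using (Σ; _×_; ∃)
open import Data.Sum using (_⊎_)
open import Relation.Binary.PropositionalEquality using (_≡_; _≢_)
open import Function.Definitions using (Injective)

-- A (host) 3-graph on vertex set Fin N: an edge indicator on triples,
-- invariant under permutation of the triple (values on triples with a
-- repeated vertex are irrelevant: embeddings below are injective).
record ThreeGraph (N : ℕ) : Set where
  field
    edge   : Fin N → Fin N → Fin N → Bool
    sym₁₂  : ∀ a b c → edge a b c ≡ edge b a c
    sym₂₃  : ∀ a b c → edge a b c ≡ edge a c b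
open ThreeGraph public

complement : ∀ {N} → ThreeGraph N → ThreeGraph N
complement G = record
  { edge  = λ a b c → not (edge G a b c)
  ; sym₁₂ = λ a b c → Relation.Binary.PropositionalEquality.cong not (sym₁₂ G a b c)
  ; sym₂₃ = λ a b c → Relation.Binary.PropositionalEquality.cong not (sym₂₃ G a b c) }

-- A pattern 3-graph given by k vertices and a predicate on ordered triples;
-- every edge {x,y,z} is required to be listed by at least one ordering.
record Pattern : Set₁ where
  field
    size  : ℕ
    pedge : Fin size → Fin size → Fin size → Set
open Pattern public

Contains : ∀ {N} → ThreeGraph N → Pattern → Set
Contains {N} G H =
  Σ (Fin (size H) → Fin N) λ f →
    Injective _≡_ _≡_ f ×
    (∀ a b c → pedge H a b c → edge G (f a) (f b) (f c) ≡ true)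

Graph : ℕ → Set₁
Graph n = Fin n → Fin n → Set

K : (n : ℕ) → Graph n
K n v w = v ≢ w

-- Link hypergraph of G with m copies of the distinguished vertex
-- (m = 1 gives L_G itself). Vertices: Fin (m + n); the first m are the
-- copies u, u', ..., the last n are V(G).
LinkCopies : (m n : ℕ) → Graph n → Pattern
LinkCopies m n G = record
  { size  = m + n
  ; pedge = λ a b c → Σ (Fin m) λ i → Σ (Fin n) λ v → Σ (Fin n) λ w →
      (a ≡ i ↑ˡ n) × (b ≡ m ↑ʳ v) × (c ≡ m ↑ʳ w) × G v w }

LK : ℕ → Pattern
LK s = LinkCopies 1 s (K s)

L : ℕ → ℕ → Pattern
L m n = LinkCopies m n (K n)

RamseyProperty : ℕ → Pattern → Pattern → Set
RamseyProperty N H₁ H₂ = (G : ThreeGraph N) → Contains G H₁ ⊎ Contains (complement G) H₂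

-- r(H₁,H₂) ≤ B  (r is the least N with the Ramsey property).
RamseyLE : Pattern → Pattern → ℕ → Set
RamseyLE H₁ H₂ B = Σ ℕ λ N → N ≤ B × RamseyProperty N H₁ H₂

bound : ℕ → ℕ → ℕ → ℕ
bound s m n = m * 2 ^ (n + 1) * ((s + n ∸ 2) C (s ∸ 1) + 1) ^ n

{-# OPTIONS --safe #-}
-- Split the vertices into a block V of size M = C(s+n-2, s-1) and a block U of (m-1) M^n + 1
-- further vertices. Each u ∈ U 2-colours the pairs of V according to whether {u,v,w} is an edge;
-- by the Erdős–Szekeres bound every such colouring has a red K_s, which together with u is a
-- copy of L_{K_s}, or a blue K_n. If every u has a blue K_n, read it as one of the M^n
-- sequences of n vertices of V: by pigeonhole m vertices of U choose the same sequence, and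
-- together they span L(m,n) in the complement. Finally M + (m-1) M^n + 1 is below the bound.
module Submission where

open import Defs
open import Data.Bool using (Bool; true; false; not; _≟_)
open import Data.Bool.Properties using (¬-not)
open import Data.Fin using (Fin; zero; suc; _↑ˡ_; _↑ʳ_; splitAt; join; inject≤; combine)
open import Data.Fin.Properties as Fin
  using (splitAt-↑ˡ; splitAt-↑ʳ; join-splitAt; inject≤-injective; combine-injective; ↑ˡ-injective; ↑ʳ-injective)
open import Data.List using (List; []; _∷_; length; filter; lookup; allFin)
open import Data.List.Properties using (length-tabulate)
open import Data.List.Membership.Propositional using (_∈_)
open import Data.List.Membership.Propositional.Properties using (∈-filter⁻; ∈-lookup; ∈-allFin)
open import Data.List.Relation.Binary.Subset.Propositional using (_⊆_)
open import Data.List.Relation.Unary.All as All using (All; []; _∷_)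
open import Data.List.Relation.Unary.All.Properties using (all-filter)
open import Data.List.Relation.Unary.AllPairs using (AllPairs; []; _∷_)
open import Data.List.Relation.Unary.Any using (here; there)
open import Data.List.Relation.Unary.Unique.Propositional using (Unique)
open import Data.List.Relation.Unary.Unique.Propositional.Properties using (allFin⁺; filter⁺)
open import Data.Nat using (ℕ; zero; suc; _+_; _*_; _^_; _≤_; _<_; z≤n; s≤s; _≤?_; _<?_; NonZero)
open import Data.Nat.Properties
  using ( +-suc; +-comm; +-identityʳ; *-suc; ≤-refl; ≤-reflexive; ≤-trans; <-≤-trans; n<1+n; n≤1+n
        ; m≤m+n; m≤m*n; <⇒≱; ≰⇒>; ≮⇒≥; +-cancelˡ-≤; +-mono-≤; +-monoˡ-≤; *-monoʳ-≤; *-monoˡ-≤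
        ; ^-monoˡ-≤; m^n≢0; module ≤-Reasoning)
open import Data.Nat.Combinatorics using (_C_; nCn≡1; nCk+nC[k+1]≡[n+1]C[k+1])
open import Data.Product using (Σ; ∃; _×_; _,_; proj₁; proj₂; map₂)
open import Data.Sum using (_⊎_; inj₁; inj₂; [_,_]′) renaming (map to ⊎-map)
open import Function using (_∘_)
open import Function.Definitions using (Injective)
open import Function.Construct.Composition using (injective)
open import Level using (0ℓ)
open import Relation.Binary.Core using (Rel)
open import Relation.Binary.Definitions using (Symmetric; DecidableEquality)
open import Relation.Binary.PropositionalEquality
  using (_≡_; _≢_; refl; sym; trans; cong; subst; subst₂; ≢-sym)
open import Relation.Nullary using (yes; no; contradiction)
open import Relation.Unary using (Decidable)
open import Relation.Unary.Properties using (∁?)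

length-filter-∁ : ∀ {A : Set} {P : A → Set} (P? : Decidable P) xs →
                  length (filter P? xs) + length (filter (∁? P?) xs) ≡ length xs
length-filter-∁ P? [] = refl
length-filter-∁ P? (x ∷ xs) with P? x
... | yes _ = cong suc (length-filter-∁ P? xs)
... | no _  = trans (+-suc _ _) (cong suc (length-filter-∁ P? xs))

+-cancel-≤-by : ∀ {u v x y} → u + v ≤ x + y → x ≤ u → v ≤ y
+-cancel-≤-by {u} {v} {x} {y} le x≤u = +-cancelˡ-≤ u v y (≤-trans le (+-monoˡ-≤ y x≤u))

module _ {A : Set} where

  lookup-AllPairs : ∀ {R : Rel A 0ℓ} → Symmetric R → ∀ {xs} → AllPairs R xs →
                    ∀ {i j} → i ≢ j → R (lookup xs i) (lookup xs j)
  lookup-AllPairs R-sym (_ ∷ _) {zero} {zero} i≢j = contradiction refl i≢j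
  lookup-AllPairs R-sym (x∼xs ∷ _) {zero} {suc j} _ = All.lookup x∼xs (∈-lookup j)
  lookup-AllPairs R-sym (x∼xs ∷ _) {suc i} {zero} _ = R-sym (All.lookup x∼xs (∈-lookup i))
  lookup-AllPairs R-sym (_ ∷ xs∼) {suc i} {suc j} i≢j =
    lookup-AllPairs R-sym xs∼ (i≢j ∘ cong suc)

  lookup-injective : ∀ {xs} → Unique xs → Injective _≡_ _≡_ (lookup xs)
  lookup-injective xs! {i} {j} eq with i Fin.≟ j
  ... | yes i≡j = i≡j
  ... | no i≢j  = contradiction eq (lookup-AllPairs ≢-sym xs! i≢j)

  prefix : ∀ {k} (xs : List A) → k ≤ length xs → Fin k → A
  prefix xs k≤ i = lookup xs (inject≤ i k≤)

  prefix-injective : ∀ {k xs} (k≤ : k ≤ length xs) → Unique xs → Injective _≡_ _≡_ (prefix xs k≤)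
  prefix-injective k≤ xs! = inject≤-injective k≤ k≤ _ _ ∘ lookup-injective xs!

  prefix-AllPairs : ∀ {R : Rel A 0ℓ} → Symmetric R → ∀ {k xs} (k≤ : k ≤ length xs) → AllPairs R xs →
                    ∀ {i j} → i ≢ j → R (prefix xs k≤ i) (prefix xs k≤ j)
  prefix-AllPairs R-sym k≤ xs∼ i≢j = lookup-AllPairs R-sym xs∼ (i≢j ∘ inject≤-injective k≤ k≤ _ _)

Clique : {A : Set} → (A → A → Bool) → Bool → ℕ → Set
Clique {A} col c k =
  Σ (Fin k → A) λ g → Injective _≡_ _≡_ g × (∀ {i j} → i ≢ j → col (g i) (g j) ≡ c)

-- R a b is the Erdős–Szekeres bound for the graph Ramsey number r(K_{a+1}, K_{b+1}).
R : ℕ → ℕ → ℕ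
R zero    b       = 1
R (suc a) zero    = 1
R (suc a) (suc b) = R a (suc b) + R (suc a) b

R>0 : ∀ a b → 0 < R a b
R>0 zero    b       = s≤s z≤n
R>0 (suc a) zero    = s≤s z≤n
R>0 (suc a) (suc b) = <-≤-trans (R>0 a (suc b)) (m≤m+n _ _)

R≡C : ∀ a b → R a b ≡ (a + b) C a
R≡C zero    b = refl
R≡C (suc a) zero rewrite +-identityʳ a = sym (nCn≡1 (suc a))
R≡C (suc a) (suc b) rewrite R≡C a (suc b) | R≡C (suc a) b | +-suc a b =
  nCk+nC[k+1]≡[n+1]C[k+1] (suc (a + b)) a

module Ramsey {A : Set} (col : A → A → Bool) (col-sym : ∀ x y → col x y ≡ col y x) where

  record ListClique (c : Bool) (k : ℕ) (xs : List A) : Set where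
    field
      members       : List A
      members⊆      : members ⊆ xs
      unique        : Unique members
      monochromatic : AllPairs (λ x y → col x y ≡ c) members
      large         : k ≤ length members

  singleton : ∀ {c x xs} → x ∈ xs → ListClique c 1 xs
  singleton {x = x} x∈xs = record
    { members = x ∷ [] ; members⊆ = λ { (here refl) → x∈xs }
    ; unique = [] ∷ [] ; monochromatic = [] ∷ [] ; large = ≤-refl }

  widen : ∀ {c k xs ys} → xs ⊆ ys → ListClique c k xs → ListClique c k ys
  widen xs⊆ys K = record
    { members = members ; members⊆ = xs⊆ys ∘ members⊆
    ; unique = unique ; monochromatic = monochromatic ; large = large }
    where open ListClique K

  extend : ∀ {c k x xs ys} → All (x ≢_) xs → (∀ {y} → y ∈ ys → y ∈ xs × col x y ≡ c) →
           ListClique c k ys → ListClique c (suc k) (x ∷ xs)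
  extend {x = x} x∉xs ys⊆ K = record
    { members       = x ∷ members
    ; members⊆      = λ { (here refl) → here refl ; (there y∈) → there (proj₁ (ys⊆ (members⊆ y∈))) }
    ; unique        = All.tabulate (λ y∈ → All.lookup x∉xs (proj₁ (ys⊆ (members⊆ y∈)))) ∷ unique
    ; monochromatic = All.tabulate (λ y∈ → proj₂ (ys⊆ (members⊆ y∈))) ∷ monochromatic
    ; large         = s≤s large }
    where open ListClique K

  red? : ∀ x → Decidable (λ y → col x y ≡ true)
  red? x y = col x y ≟ true

  ∈-red : ∀ {x y xs} → y ∈ filter (red? x) xs → y ∈ xs × col x y ≡ true
  ∈-red {x} = ∈-filter⁻ (red? x)

  ∈-blue : ∀ {x y xs} → y ∈ filter (∁? (red? x)) xs → y ∈ xs × col x y ≡ false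
  ∈-blue {x} = map₂ ¬-not ∘ ∈-filter⁻ (∁? (red? x))

  ramsey-list : ∀ a b xs → Unique xs → R a b ≤ length xs →
                ListClique true (suc a) xs ⊎ ListClique false (suc b) xs
  ramsey-list zero    b (x ∷ _) _ _ = inj₁ (singleton (here refl))
  ramsey-list (suc a) zero (x ∷ _) _ _ = inj₂ (singleton (here refl))
  ramsey-list (suc a) (suc b) [] _ R≤0 = contradiction R≤0 (<⇒≱ (R>0 (suc a) (suc b)))
  ramsey-list (suc a) (suc b) (x ∷ xs) (x∉xs ∷ xs!) R≤
    with R a (suc b) ≤? length (filter (red? x) xs)
  ... | yes many-red with ramsey-list a (suc b) _ (filter⁺ (red? x) xs!) many-red
  ...   | inj₁ K = inj₁ (extend x∉xs ∈-red K)
  ...   | inj₂ K = inj₂ (widen (there ∘ proj₁ ∘ ∈-red) K)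
  ramsey-list (suc a) (suc b) (x ∷ xs) (x∉xs ∷ xs!) R≤ | no few-red
    with ramsey-list (suc a) b _ (filter⁺ (∁? (red? x)) xs!) many-blue
    where
    many-blue : R (suc a) b ≤ length (filter (∁? (red? x)) xs)
    many-blue = +-cancel-≤-by
      (≤-trans R≤ (≤-reflexive (cong suc (sym (length-filter-∁ (red? x) xs)))))
      (≰⇒> few-red)
  ... | inj₁ K = inj₁ (widen (there ∘ proj₁ ∘ ∈-blue) K)
  ... | inj₂ K = inj₂ (extend x∉xs ∈-blue K)

  toClique : ∀ {c k xs} → ListClique c k xs → Clique col c k
  toClique K = prefix members large , prefix-injective large unique ,
               prefix-AllPairs (λ {x} {y} → trans (col-sym y x)) large monochromatic
    where open ListClique K

ramsey : ∀ {N} (col : Fin N → Fin N → Bool) → (∀ x y → col x y ≡ col y x) →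
         ∀ a b → R a b ≤ N → Clique col true (suc a) ⊎ Clique col false (suc b)
ramsey {N} col col-sym a b R≤N =
  ⊎-map toClique toClique
    (ramsey-list a b (allFin N) (allFin⁺ N) (subst (R a b ≤_) (sym (length-tabulate _)) R≤N))
  where open Ramsey col col-sym

module _ {U B : Set} (_≟ᴮ_ : DecidableEquality B) (f : U → B) where

  in-fibre? : ∀ b → Decidable (λ x → f x ≡ b)
  in-fibre? b x = f x ≟ᴮ b

  pigeonhole-list : ∀ q bs xs → Unique xs → (∀ {x} → x ∈ xs → f x ∈ bs) → q * length bs < length xs →
                    Σ B λ b → Σ (List U) λ ys → Unique ys × All (λ y → f y ≡ b) ys × q < length ys
  pigeonhole-list q [] [] _ _ ()
  pigeonhole-list q [] (x ∷ _) _ covered _ with () ← covered (here refl)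
  pigeonhole-list q (b ∷ bs) xs xs! covered q*|bs|<|xs| with q <? length (filter (in-fibre? b) xs)
  ... | yes big = b , _ , filter⁺ (in-fibre? b) xs! , all-filter (in-fibre? b) xs , big
  ... | no small = pigeonhole-list q bs _ (filter⁺ (∁? (in-fibre? b)) xs!) covered′ enough
    where
    rest : List U
    rest = filter (∁? (in-fibre? b)) xs

    covered′ : ∀ {x} → x ∈ rest → f x ∈ bs
    covered′ x∈ with x∈xs , fx≢b ← ∈-filter⁻ (∁? (in-fibre? b)) x∈ | covered x∈xs
    ... | here fx≡b   = contradiction fx≡b fx≢b
    ... | there fx∈bs = fx∈bs

    enough : q * length bs < length rest
    enough = +-cancel-≤-by (begin
      q + suc (q * length bs)                      ≡⟨ +-suc q _ ⟩
      suc (q + q * length bs)                      ≡⟨ cong suc (*-suc q (length bs)) ⟨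
      suc (q * suc (length bs))                    ≤⟨ q*|bs|<|xs| ⟩
      length xs                                    ≡⟨ length-filter-∁ (in-fibre? b) xs ⟨
      length (filter (in-fibre? b) xs) + length rest ∎) (≮⇒≥ small)
      where open ≤-Reasoning

LargeFibre : ∀ {N k} → (Fin N → Fin k) → ℕ → Set
LargeFibre {N} {k} f q =
  Σ (Fin k) λ c → Σ (Fin q → Fin N) λ us → Injective _≡_ _≡_ us × (∀ i → f (us i) ≡ c)

pigeonhole : ∀ {N k} q (f : Fin N → Fin k) → q * k < N → LargeFibre f (suc q)
pigeonhole {N} {k} q f q*k<N
  with c , ys , ys! , ys↦c , q<|ys| ← pigeonhole-list Fin._≟_ f q (allFin k) (allFin N) (allFin⁺ N)
         (λ _ → ∈-allFin _)
         (subst₂ (λ k′ N′ → q * k′ < N′) (sym (length-tabulate _)) (sym (length-tabulate _)) q*k<N)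
  = c , prefix ys q<|ys| , prefix-injective q<|ys| ys! , λ i → All.lookup ys↦c (∈-lookup _)

encode : ∀ {m} n → (Fin n → Fin m) → Fin (m ^ n)
encode zero    g = zero
encode (suc n) g = combine (g zero) (encode n (g ∘ suc))

encode-injective : ∀ {m} n {g h : Fin n → Fin m} → encode n g ≡ encode n h → ∀ i → g i ≡ h i
encode-injective (suc n) {g} {h} eq = λ
  { zero    → proj₁ heads-and-tails
  ; (suc i) → encode-injective n (proj₂ heads-and-tails) i }
  where
  heads-and-tails : g zero ≡ h zero × encode n (g ∘ suc) ≡ encode n (h ∘ suc)
  heads-and-tails = combine-injective (g zero) (encode n (g ∘ suc)) (h zero) (encode n (h ∘ suc)) eq

splitAt-injective : ∀ m {n} → Injective _≡_ _≡_ (splitAt m {n})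
splitAt-injective m {n} {x} {y} eq =
  trans (sym (join-splitAt m n x)) (trans (cong (join m n) eq) (join-splitAt m n y))

[,]-injective : ∀ {A B C : Set} {p : A → C} {q : B → C} →
                Injective _≡_ _≡_ p → Injective _≡_ _≡_ q → (∀ a b → p a ≢ q b) →
                Injective _≡_ _≡_ [ p , q ]′
[,]-injective p-inj q-inj disjoint {inj₁ a} {inj₁ a′} eq = cong inj₁ (p-inj eq)
[,]-injective p-inj q-inj disjoint {inj₁ a} {inj₂ b}  eq = contradiction eq (disjoint a b)
[,]-injective p-inj q-inj disjoint {inj₂ b} {inj₁ a}  eq = contradiction (sym eq) (disjoint a b)
[,]-injective p-inj q-inj disjoint {inj₂ b} {inj₂ b′} eq = cong inj₂ (q-inj eq)

↑ʳ≢↑ˡ : ∀ {m n} (i : Fin n) (j : Fin m) → m ↑ʳ i ≢ j ↑ˡ n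
↑ʳ≢↑ˡ {m} {n} i j eq with () ← trans (sym (splitAt-↑ʳ m n i)) (trans (cong (splitAt m) eq) (splitAt-↑ˡ m j n))

linkCopies-embedding : ∀ {N m n} (H : ThreeGraph N) (F : Graph n) (us : Fin m → Fin N) (g : Fin n → Fin N) →
                       Injective _≡_ _≡_ us → Injective _≡_ _≡_ g → (∀ i v → us i ≢ g v) →
                       (∀ i {v w} → F v w → edge H (us i) (g v) (g w) ≡ true) →
                       Contains H (LinkCopies m n F)
linkCopies-embedding {N} {m} {n} H F us g us-inj g-inj disjoint link =
  embedding , injective _≡_ _≡_ _≡_ (splitAt-injective m) ([,]-injective us-inj g-inj disjoint) , preserves
  where
  embedding : Fin (m + n) → Fin N
  embedding = [ us , g ]′ ∘ splitAt m

  preserves : ∀ x y z → pedge (LinkCopies m n F) x y z →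
              edge H (embedding x) (embedding y) (embedding z) ≡ true
  preserves _ _ _ (i , v , w , refl , refl , refl , Fvw)
    rewrite splitAt-↑ˡ m i n | splitAt-↑ʳ m n v | splitAt-↑ʳ m n w = link i Fvw

∃-or-∀ : ∀ {k} {P Q : Fin k → Set} → (∀ i → P i ⊎ Q i) → (∃ P) ⊎ (∀ i → Q i)
∃-or-∀ {zero}  P⊎Q = inj₂ λ ()
∃-or-∀ {suc k} P⊎Q with P⊎Q zero | ∃-or-∀ (P⊎Q ∘ suc)
... | inj₁ p | _             = inj₁ (zero , p)
... | inj₂ _ | inj₁ (i , p)  = inj₁ (suc i , p)
... | inj₂ q | inj₂ qs       = inj₂ λ { zero → q ; (suc i) → qs i }

-- Vertices 0..M-1 carry the cliques; the remaining m′ P + 1 are candidates for the distinguished vertex.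
module LinkRamsey (a b m′ : ℕ) where

  M P N : ℕ
  M = R a b
  P = M ^ suc b
  N = M + suc (m′ * P)

  module _ (G : ThreeGraph N) where

    colour : Fin (suc (m′ * P)) → Fin M → Fin M → Bool
    colour u v w = edge G (M ↑ʳ u) (v ↑ˡ _) (w ↑ˡ _)

    red-link : ∀ u → Clique (colour u) true (suc a) → Contains G (LK (suc a))
    red-link u (g , g-inj , red) =
      linkCopies-embedding G (K (suc a)) (λ _ → M ↑ʳ u) (λ v → g v ↑ˡ _)
        (λ { {zero} {zero} _ → refl }) (g-inj ∘ ↑ˡ-injective _ _ _) (λ _ v → ↑ʳ≢↑ˡ u (g v)) (λ _ → red)

    blue-link : (∀ u → Clique (colour u) false (suc b)) → Contains (complement G) (L (suc m′) (suc b))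
    blue-link blue = embed (pigeonhole m′ (encode (suc b) ∘ clique) (n<1+n _))
      where
      clique : ∀ u → Fin (suc b) → Fin M
      clique u = proj₁ (blue u)

      embed : LargeFibre (encode (suc b) ∘ clique) (suc m′) →
              Contains (complement G) (L (suc m′) (suc b))
      embed (c , us , us-inj , us↦c) =
        linkCopies-embedding (complement G) (K (suc b)) (λ i → M ↑ʳ us i) (λ v → g v ↑ˡ _)
          (us-inj ∘ ↑ʳ-injective M _ _) (proj₁ (proj₂ (blue (us zero))) ∘ ↑ˡ-injective _ _ _)
          (λ i v → ↑ʳ≢↑ˡ (us i) (g v)) blue-edge
        where
        g : Fin (suc b) → Fin M
        g = clique (us zero)

        agree : ∀ i v → clique (us i) v ≡ g v
        agree i = encode-injective (suc b) (trans (us↦c i) (sym (us↦c zero)))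

        blue-edge : ∀ i {v w} → v ≢ w → not (colour (us i) (g v) (g w)) ≡ true
        blue-edge i v≢w = cong not (subst₂ (λ x y → colour (us i) x y ≡ false)
          (agree i _) (agree i _) (proj₂ (proj₂ (blue (us i))) v≢w))

    ramseyProperty : Contains G (LK (suc a)) ⊎ Contains (complement G) (L (suc m′) (suc b))
    ramseyProperty with ∃-or-∀ (λ u → ramsey (colour u) (λ _ _ → sym₂₃ G _ _ _) a b ≤-refl)
    ... | inj₁ (u , red) = inj₁ (red-link u red)
    ... | inj₂ blue      = inj₂ (blue-link blue)

vertices≤bound : ∀ M m′ n t .{{_ : NonZero t}} → M + suc (m′ * M ^ suc n) ≤ suc m′ * t * suc M ^ suc n
vertices≤bound M m′ n t = begin
  M + suc (m′ * M ^ suc n)   ≡⟨ +-suc M _ ⟩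
  suc M + m′ * M ^ suc n     ≤⟨ +-mono-≤ (m≤m*n (suc M) (suc M ^ n) {{m^n≢0 (suc M) n}})
                                         (*-monoʳ-≤ m′ (^-monoˡ-≤ (suc n) (n≤1+n M))) ⟩
  suc m′ * X                 ≤⟨ *-monoˡ-≤ X (m≤m*n (suc m′) t) ⟩
  suc m′ * t * X             ∎
  where
  open ≤-Reasoning
  X = suc M ^ suc n

bound≡ : ∀ a m′ b → bound (suc a) (suc m′) (suc b) ≡ suc m′ * 2 ^ (suc b + 1) * suc (R a b) ^ suc b
bound≡ a m′ b rewrite +-suc a b | R≡C a b =
  cong (λ k → suc m′ * 2 ^ (suc b + 1) * k ^ suc b) (+-comm _ 1)

corollary6p4 : (s m n : ℕ) → 1 ≤ s → 1 ≤ m → 1 ≤ n →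
               RamseyLE (LK s) (L m n) (bound s m n)
corollary6p4 (suc a) (suc m′) (suc b) _ _ _ =
  N , ≤-trans (vertices≤bound (R a b) m′ b (2 ^ (suc b + 1)) {{m^n≢0 2 (suc b + 1)}})
              (≤-reflexive (sym (bound≡ a m′ b))) ,
  ramseyProperty
  where open LinkRamsey a b m′
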